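{- Let $p\in\mathbb{T}^{\mathcal{P}(n)}$ be a tropical Wick vector and let $M$ be the even $\Delta$-matroid with set of bases $\mathrm{supp}(p)$. Then: (1) if $x\in\mathcal{C}(p)^{\top}$ has nonempty support, then $\mathrm{supp}(x)$ is dependent in $M^*$; (2) the cocycles of $p$ with minimal nonempty support (with respect to inclusion) are exactly the cocircuits of $p$; (3) for any two cocircuits $c^*_1,c^*_2$ of $p$ with the same support there is $\lambda\in\mathbb{R}$ with $c^*_1=\lambda\odot c^*_2$ (i.e. $c^*_1=c^*_2+\lambda\mathbf{1}$).
   Context: $[n]=\{1,\dots,n\}$, $\mathcal{P}(n)$ its power set, $\mathbb{T}=\mathbb{R}\cup\{\infty\}$, $\mathrm{supp}(x)$ = set of coordinates not equal to $\infty$. $p$ is a tropical Wick vector if for all $S,T\subseteq[n]$ the minimum $\min_{i\in S\Delta T}(p_{S\Delta\{i\}}+p_{T\Delta\{i\}})$ is attained at least twice or equals $\infty$; its support is then the set of bases of an even $\Delta$-matroid $M$ (nonempty family $\mathcal{B}$ of subsets with: for $A,B\in\mathcal{B}$, $a\in A\Delta B$ there is $b\in A\Delta B$, $b\neq a$, $A\Delta\{a,b\}\in\mathcal{B}$). The dual $M^*$ has bases $\{[n]\setminus B: B\in\mathcal{B}\}$. Let $\mathcal{J}=[n]\cup[n]^*$ with involution $i\leftrightarrow i^*$; $J\subseteq\mathcal{J}$ is admissible if $J\cap J^*=\emptyset$. For $S\subseteq[n]$, $\bar S=S\cup([n]\setminus S)^*$, and $\bar p_{\bar S}=p_S$. A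 subset of $\mathcal{J}$ is independent in an even $\Delta$-matroid $N$ if it is contained in $\bar B$ for some basis $B$ of $N$, dependent otherwise. For $T\subseteq[n]$: $(c_T)_i=\bar p_{\bar T\Delta\{i,i^*\}}$ if $i\in\bar T$, else $\infty$; $(c^*_T)_i=\bar p_{\bar T\Delta\{i,i^*\}}$ if $i\notin\bar T$, else $\infty$. Circuits (resp. cocircuits) of $p$ are the vectors $c_T+\lambda\mathbf{1}$ (resp. $c^*_T+\lambda\mathbf{1}$), $\lambda\in\mathbb{R}$, with nonempty support; $\mathcal{C}(p)$ is the set of circuits. $x,y$ are tropically orthogonal if $\min_k(x_k+y_k)$ is attained at least twice or is $\infty$; $X^\top$ is the set of vectors tropically orthogonal to all elements of $X$. A cocycle of $p$ is an $x\in\mathcal{C}(p)^\top$ whose support is admissible. -}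

module Defs where

open import Level using (0ℓ)
open import Data.Nat using (ℕ)
open import Data.Bool using (Bool; true; false; _xor_; not; if_then_else_)
open import Data.Fin using (Fin)
open import Data.Fin.Subset using (Subset; _∈_; _∉_; ⁅_⁆; ∁)
open import Data.Vec using (zipWith; lookup)
open import Data.Sum using (_⊎_; inj₁; inj₂)
open import Data.Product using (Σ; ∃; _×_; _,_)
open import Data.Empty using (⊥)
open import Data.Unit using (⊤)
open import Relation.Nullary using (¬_)
open import Relation.Binary.PropositionalEquality using (_≡_; _≢_)

-- The real numbers, axiomatised as a Dedekind-complete ordered field.
-- (agda-stdlib has no reals; every model of this record is isomorphic
-- to ℝ, so quantifying over all models is the same as stating the
-- result for ℝ.)

record Reals : Set₁ where
  infixl 6 _+_
  infixl 7 _*_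
  infix 4 _≤_
  field
    ℝ   : Set
    _+_ : ℝ → ℝ → ℝ
    _*_ : ℝ → ℝ → ℝ
    -_  : ℝ → ℝ
    0ℝ  : ℝ
    1ℝ  : ℝ
    _≤_ : ℝ → ℝ → Set
    +-assoc   : ∀ a b c → (a + b) + c ≡ a + (b + c)
    +-comm    : ∀ a b → a + b ≡ b + a
    +-identity : ∀ a → a + 0ℝ ≡ a
    +-inverse : ∀ a → a + (- a) ≡ 0ℝ
    *-assoc   : ∀ a b c → (a * b) * c ≡ a * (b * c)
    *-comm    : ∀ a b → a * b ≡ b * a
    *-identity : ∀ a → a * 1ℝ ≡ a
    *-inverse : ∀ a → a ≢ 0ℝ → Σ ℝ (λ b → a * b ≡ 1ℝ)
    distrib   : ∀ a b c → a * (b + c) ≡ (a * b) + (a * c)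
    0≢1       : 0ℝ ≢ 1ℝ
    ≤-refl    : ∀ a → a ≤ a
    ≤-trans   : ∀ a b c → a ≤ b → b ≤ c → a ≤ c
    ≤-antisym : ∀ a b → a ≤ b → b ≤ a → a ≡ b
    ≤-total   : ∀ a b → a ≤ b ⊎ b ≤ a
    +-mono    : ∀ a b c → a ≤ b → a + c ≤ b + c
    *-pos     : ∀ a b → 0ℝ ≤ a → 0ℝ ≤ b → 0ℝ ≤ a * b
    complete  : (P : ℝ → Set) → Σ ℝ P → Σ ℝ (λ u → ∀ a → P a → a ≤ u) →
                Σ ℝ (λ s → (∀ a → P a → a ≤ s) ×
                           (∀ u → (∀ a → P a → a ≤ u) → s ≤ u))

module Tropical (R : Reals) where
  open Reals R

  data 𝕋 : Set where
    fin : ℝ → 𝕋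
    ∞   : 𝕋

  infixl 6 _⊙_
  _⊙_ : 𝕋 → 𝕋 → 𝕋
  fin a ⊙ fin b = fin (a + b)
  fin a ⊙ ∞     = ∞
  ∞     ⊙ y     = ∞

  _≤𝕋_ : 𝕋 → 𝕋 → Set
  fin a ≤𝕋 fin b = a ≤ b
  fin a ≤𝕋 ∞     = ⊤
  ∞     ≤𝕋 fin b = ⊥
  ∞     ≤𝕋 ∞     = ⊤

  MinTwice : {I : Set} → (I → Set) → (I → 𝕋) → Set
  MinTwice {I} P f =
    (∀ k → P k → f k ≡ ∞) ⊎
    Σ I (λ i → Σ I (λ j → i ≢ j × P i × P j × f i ≡ f j ×
                          (∀ k → P k → f i ≤𝕋 f k)))

  _Δ_ : {n : ℕ} → Subset n → Subset n → Subset n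
  S Δ T = zipWith _xor_ S T

  IsWick : {n : ℕ} → (Subset n → 𝕋) → Set
  IsWick p = ∀ S T → MinTwice (λ i → i ∈ (S Δ T))
                              (λ i → p (S Δ ⁅ i ⁆) ⊙ p (T Δ ⁅ i ⁆))

  -- 𝒥 = [n] ∪ [n]* : inj₁ i is i, inj₂ i is i*.
  𝒥 : ℕ → Set
  𝒥 n = Fin n ⊎ Fin n

  _* : {n : ℕ} → 𝒥 n → 𝒥 n
  inj₁ i * = inj₂ i
  inj₂ i * = inj₁ i

  base : {n : ℕ} → 𝒥 n → Fin n
  base (inj₁ i) = i
  base (inj₂ i) = i

  Pred𝒥 : ℕ → Set₁
  Pred𝒥 n = 𝒥 n → Set

  _⊆𝒥_ : {n : ℕ} → Pred𝒥 n → Pred𝒥 n → Set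
  A ⊆𝒥 B = ∀ j → A j → B j

  Admissible : {n : ℕ} → Pred𝒥 n → Set
  Admissible A = ∀ j → ¬ (A j × A (j *))

  -- S̄ = S ∪ ([n] ∖ S)*
  -- (membership of i ∈ [n] in S is the Boolean  lookup S i)
  barB : {n : ℕ} → Subset n → 𝒥 n → Bool
  barB S (inj₁ i) = lookup S i
  barB S (inj₂ i) = not (lookup S i)

  bar : {n : ℕ} → Subset n → Pred𝒥 n
  bar S j = barB S j ≡ true

  Vec𝒥 : ℕ → Set
  Vec𝒥 n = 𝒥 n → 𝕋

  supp : {n : ℕ} → Vec𝒥 n → Pred𝒥 n
  supp x j = x j ≢ ∞

  NonemptySupp : {n : ℕ} → Vec𝒥 n → Set
  NonemptySupp {n} x = Σ (𝒥 n) (λ j → x j ≢ ∞)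

  _+𝟏_ : {n : ℕ} → Vec𝒥 n → ℝ → Vec𝒥 n
  (x +𝟏 λ′) j = x j ⊙ fin λ′

  Independent : {n : ℕ} → (Subset n → Set) → Pred𝒥 n → Set
  Independent {n} Bases A = Σ (Subset n) (λ B → Bases B × A ⊆𝒥 bar B)

  Dependent : {n : ℕ} → (Subset n → Set) → Pred𝒥 n → Set
  Dependent Bases A = ¬ Independent Bases A

  BasesM : {n : ℕ} → (Subset n → 𝕋) → Subset n → Set
  BasesM p B = p B ≢ ∞

  BasesM* : {n : ℕ} → (Subset n → 𝕋) → Subset n → Set
  BasesM* p B = p (∁ B) ≢ ∞

  -- c_T and c*_T.  Note  T̄ Δ {i,i*} = bar (T Δ {base i}), so
  -- p̄_{T̄ Δ {i,i*}} = p_{T Δ {base i}}.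
  c : {n : ℕ} → (Subset n → 𝕋) → Subset n → Vec𝒥 n
  c p T j = if barB T j then p (T Δ ⁅ base j ⁆) else ∞

  c* : {n : ℕ} → (Subset n → 𝕋) → Subset n → Vec𝒥 n
  c* p T j = if barB T j then ∞ else p (T Δ ⁅ base j ⁆)

  IsCircuit : {n : ℕ} → (Subset n → 𝕋) → Vec𝒥 n → Set
  IsCircuit {n} p x =
    Σ (Subset n) (λ T → Σ ℝ (λ λ′ → (∀ j → x j ≡ (c p T +𝟏 λ′) j))) × NonemptySupp x

  IsCocircuit : {n : ℕ} → (Subset n → 𝕋) → Vec𝒥 n → Set
  IsCocircuit {n} p x =
    Σ (Subset n) (λ T → Σ ℝ (λ λ′ → (∀ j → x j ≡ (c* p T +𝟏 λ′) j))) × NonemptySupp x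

  Orth : {n : ℕ} → Vec𝒥 n → Vec𝒥 n → Set
  Orth x y = MinTwice (λ _ → ⊤) (λ k → x k ⊙ y k)

  InCircuitsPerp : {n : ℕ} → (Subset n → 𝕋) → Vec𝒥 n → Set
  InCircuitsPerp p x = ∀ y → IsCircuit p y → Orth x y

  IsCocycle : {n : ℕ} → (Subset n → 𝕋) → Vec𝒥 n → Set
  IsCocycle p x = InCircuitsPerp p x × Admissible (supp x)

  IsMinimalCocycle : {n : ℕ} → (Subset n → 𝕋) → Vec𝒥 n → Set
  IsMinimalCocycle p x =
    IsCocycle p x × NonemptySupp x ×
    (∀ y → IsCocycle p y → NonemptySupp y → supp y ⊆𝒥 supp x → supp x ⊆𝒥 supp y)

-- At an index k the product c*_T(k) ⊙ c_A(k) is finite only when k is the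
-- element of Ā over some i ∈ T Δ A, and then it equals p_{T Δ i} ⊙ p_{A Δ i};
-- so the Wick relation for (T, A) is exactly the orthogonality of c*_T and c_A.
--
-- Conversely, let x be orthogonal to all circuits. If supp x missed B̄ for a
-- basis B, the circuit c_A with A = B Δ {j}, j ∈ supp x, would meet supp x in
-- j alone and the minimum of x ⊙ c_A would be attained once. This gives (1)
-- (with B the complement of a basis of M*), shows that cocircuits have minimal
-- support, and drives a descent: for j ∈ supp x ∩ B̄ the cocircuit c*_{B Δ {j}}
-- has j in its support; if that support is not inside supp x it contains some
-- k ∉ supp x, and B′ = B Δ {j, k} is a basis with supp x ∩ B̄′ ⊂ supp x ∩ B̄
-- (over j, B̄′ contains j*, which is outside supp x by admissibility). Finally,
-- on a common support the circuits c_A with A = T Δ {j, j₀} force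
-- x(j) − c*_T(j) to be constant, which gives the uniqueness up to shifts in
-- (2) and (3).
module Submission where

open import Defs
open import Level using (0ℓ)
open import Algebra.Bundles using (CommutativeSemigroup)
open import Data.Nat using (ℕ)
open import Data.Bool using (Bool; true; false; not; _xor_; if_then_else_)
open import Data.Bool.Properties
  using (xor-assoc; xor-comm; xor-same; xor-identityʳ; xor-annihilates-not;
         not-involutive; not-injective; not-¬; ¬-not)
  renaming (_≟_ to _≟𝔹_)
open import Data.Fin using (Fin)
open import Data.Fin.Properties using (any?) renaming (_≟_ to _≟Fin_)
open import Data.Fin.Subset using (Subset; _∈_; _⊂_; ⁅_⁆; ∁)
open import Data.Fin.Subset.Properties using (x∈⁅x⁆; x∈⁅y⁆⇒x≡y)
open import Data.Fin.Subset.Induction using (⊂-wellFounded)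
open import Data.Vec using ([]; _∷_; lookup; tabulate; replicate)
open import Data.Vec.Properties
  using (lookup-zipWith; lookup-map; lookup∘tabulate; []=⇒lookup; lookup⇒[]=;
         zipWith-assoc; zipWith-comm; zipWith-identityʳ)
open import Data.Sum using (_⊎_; inj₁; inj₂)
open import Data.Sum.Properties using (≡-dec)
open import Data.Product using (Σ; ∃; _×_; _,_; proj₁; proj₂)
open import Data.Empty using (⊥; ⊥-elim)
open import Data.Unit using (⊤; tt)
open import Function.Base using (_∘_; _on_)
open import Function.Bundles using (_⇔_; mk⇔)
open import Induction.WellFounded using (Acc; acc)
import Relation.Binary.Construct.On as On
open import Relation.Binary.Definitions using (DecidableEquality)
open import Relation.Binary.PropositionalEquality
open import Relation.Binary.PropositionalEquality.Algebra using (isMagma)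
open import Relation.Nullary using (¬_; Dec; yes; no; contradiction)
open import Relation.Nullary.Decidable
  using (map′; _×-dec_; _⊎-dec_; ¬?; decidable-stable)

module Proof (R : Reals) where
  open Reals R
  open Tropical R

  -- Arithmetic in 𝕋

  +-commutativeSemigroup : CommutativeSemigroup 0ℓ 0ℓ
  +-commutativeSemigroup = record
    { isCommutativeSemigroup = record
      { isSemigroup = record { isMagma = isMagma _+_ ; assoc = +-assoc }
      ; comm = +-comm
      }
    }

  open import Algebra.Properties.CommutativeSemigroup +-commutativeSemigroup
    using (interchange)

  +-cancelʳ : ∀ a b → (a + b) + - b ≡ a
  +-cancelʳ a b = begin
    (a + b) + - b  ≡⟨ +-assoc a b (- b) ⟩
    a + (b + - b)  ≡⟨ cong (a +_) (+-inverse b) ⟩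
    a + 0ℝ         ≡⟨ +-identity a ⟩
    a              ∎
    where open ≡-Reasoning

  ⊙-identityʳ : ∀ t → t ⊙ fin 0ℝ ≡ t
  ⊙-identityʳ (fin a) = cong fin (+-identity a)
  ⊙-identityʳ ∞       = refl

  ⊙-zeroʳ : ∀ t → t ⊙ ∞ ≡ ∞
  ⊙-zeroʳ (fin a) = refl
  ⊙-zeroʳ ∞       = refl

  ⊙-assoc-fin : ∀ t a b → (t ⊙ fin a) ⊙ fin b ≡ t ⊙ fin (a + b)
  ⊙-assoc-fin (fin s) a b = cong fin (+-assoc s a b)
  ⊙-assoc-fin ∞       a b = refl

  ⊙-comm-fin : ∀ a t → fin a ⊙ t ≡ t ⊙ fin a
  ⊙-comm-fin a (fin t) = cong fin (+-comm a t)
  ⊙-comm-fin a ∞       = refl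

  ⊙-cancel-fin : ∀ t a → (t ⊙ fin a) ⊙ fin (- a) ≡ t
  ⊙-cancel-fin (fin s) a = cong fin (+-cancelʳ s a)
  ⊙-cancel-fin ∞       a = refl

  ⊙-interchange-fin : ∀ s t a b → (s ⊙ fin a) ⊙ (t ⊙ fin b) ≡ (s ⊙ t) ⊙ fin (a + b)
  ⊙-interchange-fin (fin s) (fin t) a b = cong fin (interchange s a t b)
  ⊙-interchange-fin (fin s) ∞       a b = refl
  ⊙-interchange-fin ∞       t       a b = refl

  ⊙-finite : ∀ {s t} → s ≢ ∞ → t ≢ ∞ → s ⊙ t ≢ ∞
  ⊙-finite {fin s} {fin t} _  _  ()
  ⊙-finite {fin s} {∞}     _  t≢ = ⊥-elim (t≢ refl)
  ⊙-finite {∞}             s≢ _  = ⊥-elim (s≢ refl)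

  ⊙-fin-≡∞ : ∀ t a → t ⊙ fin a ≡ ∞ → t ≡ ∞
  ⊙-fin-≡∞ ∞ a _ = refl

  ⊙-balance : ∀ s t a b → s ⊙ fin b ≡ fin a ⊙ t → s ≡ t ⊙ fin (a + - b)
  ⊙-balance s t a b e = begin
    s                        ≡⟨ sym (⊙-cancel-fin s b) ⟩
    (s ⊙ fin b) ⊙ fin (- b)  ≡⟨ cong (_⊙ fin (- b)) (trans e (⊙-comm-fin a t)) ⟩
    (t ⊙ fin a) ⊙ fin (- b)  ≡⟨ ⊙-assoc-fin t a (- b) ⟩
    t ⊙ fin (a + - b)        ∎
    where open ≡-Reasoning

  ⊙-monoˡ-≤ : ∀ t u a → t ≤𝕋 u → (t ⊙ fin a) ≤𝕋 (u ⊙ fin a)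
  ⊙-monoˡ-≤ (fin t) (fin u) a t≤u = +-mono t u a t≤u
  ⊙-monoˡ-≤ (fin t) ∞       a _   = tt
  ⊙-monoˡ-≤ ∞       ∞       a _   = tt

  ≤𝕋-∞ : ∀ t → t ≤𝕋 ∞
  ≤𝕋-∞ (fin t) = tt
  ≤𝕋-∞ ∞       = tt

  ≤𝕋-finite : ∀ t u → t ≤𝕋 u → u ≢ ∞ → t ≢ ∞
  ≤𝕋-finite (fin t) u       _  _  ()
  ≤𝕋-finite ∞       ∞       _  u≢ = ⊥-elim (u≢ refl)

  _≟∞ : (t : 𝕋) → Dec (t ≡ ∞)
  fin t ≟∞ = no λ ()
  ∞     ≟∞ = yes refl

  fin-of : ∀ t → t ≢ ∞ → ∃ λ a → t ≡ fin a
  fin-of (fin a) _  = a , refl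
  fin-of ∞       t≢ = ⊥-elim (t≢ refl)

  isFinite : 𝕋 → Bool
  isFinite (fin _) = true
  isFinite ∞       = false

  isFinite-true : ∀ {t} → isFinite t ≡ true → t ≢ ∞
  isFinite-true {fin t} _ ()

  finite⇒isFinite : ∀ {t} → t ≢ ∞ → isFinite t ≡ true
  finite⇒isFinite {fin t} _  = refl
  finite⇒isFinite {∞}     t≢ = ⊥-elim (t≢ refl)

  -- Minima attained twice

  module _ {I : Set} {P : I → Set} where

    MinTwice-ext : ∀ {f g : I → 𝕋} → f ≗ g → MinTwice P f → MinTwice P g
    MinTwice-ext f≗g (inj₁ all∞) = inj₁ λ k Pk → trans (sym (f≗g k)) (all∞ k Pk)
    MinTwice-ext f≗g (inj₂ (i , i′ , i≢i′ , Pi , Pi′ , fi≡fi′ , min)) =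
      inj₂ (i , i′ , i≢i′ , Pi , Pi′ , trans (sym (f≗g i)) (trans fi≡fi′ (f≗g i′)) ,
            λ k Pk → subst₂ _≤𝕋_ (f≗g i) (f≗g k) (min k Pk))

    MinTwice-shift : ∀ {f : I → 𝕋} a → MinTwice P f → MinTwice P (λ k → f k ⊙ fin a)
    MinTwice-shift a (inj₁ all∞) = inj₁ λ k Pk → cong (_⊙ fin a) (all∞ k Pk)
    MinTwice-shift {f} a (inj₂ (i , i′ , i≢i′ , Pi , Pi′ , fi≡fi′ , min)) =
      inj₂ (i , i′ , i≢i′ , Pi , Pi′ , cong (_⊙ fin a) fi≡fi′ ,
            λ k Pk → ⊙-monoˡ-≤ (f i) (f k) a (min k Pk))

    MinTwice-reindex : ∀ {J : Set} {f : I → 𝕋} {g : J → 𝕋} (r : I → J) (b : J → I) →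
                       (∀ i → b (r i) ≡ i) → (∀ i → P i → g (r i) ≡ f i) →
                       (∀ k → g k ≡ ∞ ⊎ (P (b k) × g k ≡ f (b k))) →
                       MinTwice P f → MinTwice (λ _ → ⊤) g
    MinTwice-reindex {f = f} {g} r b b∘r g∘r cover (inj₁ all∞) = inj₁ λ k _ → at k (cover k)
      where
      at : ∀ k → g k ≡ ∞ ⊎ (P (b k) × g k ≡ f (b k)) → g k ≡ ∞
      at k (inj₁ gk≡∞)       = gk≡∞
      at k (inj₂ (Pbk , gk)) = trans gk (all∞ (b k) Pbk)
    MinTwice-reindex {f = f} {g} r b b∘r g∘r cover
                     (inj₂ (i , i′ , i≢i′ , Pi , Pi′ , fi≡fi′ , min)) =
      inj₂ (r i , r i′ , r-injective , tt , tt ,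
            trans (g∘r i Pi) (trans fi≡fi′ (sym (g∘r i′ Pi′))) , λ k _ → below k (cover k))
      where
      r-injective : r i ≢ r i′
      r-injective e = i≢i′ (trans (sym (b∘r i)) (trans (cong b e) (b∘r i′)))
      below : ∀ k → g k ≡ ∞ ⊎ (P (b k) × g k ≡ f (b k)) → g (r i) ≤𝕋 g k
      below k (inj₁ gk≡∞)       = subst (g (r i) ≤𝕋_) (sym gk≡∞) (≤𝕋-∞ (g (r i)))
      below k (inj₂ (Pbk , gk)) = subst₂ _≤𝕋_ (sym (g∘r i Pi)) (sym gk) (min (b k) Pbk)

  module _ {I : Set} (_≟_ : DecidableEquality I) {f : I → 𝕋} where

    private
      two-finite-points : MinTwice (λ _ → ⊤) f → ∀ j → f j ≢ ∞ →
                          ∃ λ i → ∃ λ i′ →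
                            i ≢ i′ × f i ≡ f i′ × f i ≢ ∞ × f i′ ≢ ∞
      two-finite-points (inj₁ all∞) j fj = ⊥-elim (fj (all∞ j tt))
      two-finite-points (inj₂ (i , i′ , i≢i′ , _ , _ , fi≡fi′ , min)) j fj =
        i , i′ , i≢i′ , fi≡fi′ , fi , fi ∘ trans fi≡fi′
        where fi = ≤𝕋-finite (f i) (f j) (min j tt) fj

    MinTwice-not-single : MinTwice (λ _ → ⊤) f → ∀ j → f j ≢ ∞ →
                          (∀ l → l ≢ j → f l ≡ ∞) → ⊥
    MinTwice-not-single mt j fj rest with two-finite-points mt j fj
    ... | i , i′ , i≢i′ , _ , fi , fi′ = i≢i′ (trans (at i fi) (sym (at i′ fi′)))
      where
      at : ∀ l → f l ≢ ∞ → l ≡ j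
      at l fl = decidable-stable (l ≟ j) (fl ∘ rest l)

    MinTwice-pair : MinTwice (λ _ → ⊤) f → ∀ j k → f j ≢ ∞ →
                    (∀ l → l ≢ j → l ≢ k → f l ≡ ∞) → f j ≡ f k
    MinTwice-pair mt j k fj rest with two-finite-points mt j fj
    ... | i , i′ , i≢i′ , fi≡fi′ , fi , fi′ = pair (at i fi) (at i′ fi′)
      where
      at : ∀ l → f l ≢ ∞ → l ≡ j ⊎ l ≡ k
      at l fl with l ≟ j | l ≟ k
      ... | yes l≡j | _       = inj₁ l≡j
      ... | no _    | yes l≡k = inj₂ l≡k
      ... | no l≢j  | no l≢k  = ⊥-elim (fl (rest l l≢j l≢k))
      pair : i ≡ j ⊎ i ≡ k → i′ ≡ j ⊎ i′ ≡ k → f j ≡ f k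
      pair (inj₁ refl) (inj₂ refl) = fi≡fi′
      pair (inj₂ refl) (inj₁ refl) = sym fi≡fi′
      pair (inj₁ refl) (inj₁ e)    = ⊥-elim (i≢i′ (sym e))
      pair (inj₂ refl) (inj₂ e)    = ⊥-elim (i≢i′ (sym e))

  -- Symmetric differences and barred sets

  Δ-self : ∀ {n} (U : Subset n) → U Δ U ≡ replicate n false
  Δ-self []      = refl
  Δ-self (u ∷ U) = cong₂ _∷_ (xor-same u) (Δ-self U)

  Δ-cancelʳ : ∀ {n} (S U : Subset n) → (S Δ U) Δ U ≡ S
  Δ-cancelʳ {n} S U = begin
    (S Δ U) Δ U            ≡⟨ zipWith-assoc xor-assoc S U U ⟩
    S Δ (U Δ U)            ≡⟨ cong (S Δ_) (Δ-self U) ⟩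
    S Δ replicate n false  ≡⟨ zipWith-identityʳ xor-identityʳ S ⟩
    S                      ∎
    where open ≡-Reasoning

  Δ-exchange : ∀ {n} (S U V : Subset n) → ((S Δ U) Δ V) Δ U ≡ S Δ V
  Δ-exchange S U V = begin
    ((S Δ U) Δ V) Δ U  ≡⟨ zipWith-assoc xor-assoc (S Δ U) V U ⟩
    (S Δ U) Δ (V Δ U)  ≡⟨ cong ((S Δ U) Δ_) (zipWith-comm xor-comm V U) ⟩
    (S Δ U) Δ (U Δ V)  ≡⟨ sym (zipWith-assoc xor-assoc (S Δ U) U V) ⟩
    ((S Δ U) Δ U) Δ V  ≡⟨ cong (_Δ V) (Δ-cancelʳ S U) ⟩
    S Δ V              ∎
    where open ≡-Reasoning

  module _ {n : ℕ} where

    SameSupp : Vec𝒥 n → Vec𝒥 n → Set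
    SameSupp x y = ∀ j → (x j ≡ ∞ → y j ≡ ∞) × (y j ≡ ∞ → x j ≡ ∞)

    SameSupp⇒⊆ : ∀ {x y} → SameSupp x y → supp x ⊆𝒥 supp y
    SameSupp⇒⊆ same j xj = xj ∘ proj₂ (same j)

    SameSupp-trans : ∀ {x y z} → SameSupp x y → SameSupp y z → SameSupp x z
    SameSupp-trans x~y y~z j = proj₁ (y~z j) ∘ proj₁ (x~y j) , proj₂ (x~y j) ∘ proj₂ (y~z j)

    ⊆⊇⇒SameSupp : ∀ {x y} → supp x ⊆𝒥 supp y → supp y ⊆𝒥 supp x → SameSupp x y
    ⊆⊇⇒SameSupp {x} {y} x⊆y y⊆x j =
      (λ xj≡∞ → decidable-stable (y j ≟∞) λ yj → y⊆x j yj xj≡∞) ,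
      (λ yj≡∞ → decidable-stable (x j ≟∞) λ xj → x⊆y j xj yj≡∞)

    ≗+𝟏⇒SameSupp : ∀ {x y a} → x ≗ y +𝟏 a → SameSupp x y
    ≗+𝟏⇒SameSupp {x} {y} {a} x≗ j =
      (λ xj≡∞ → ⊙-fin-≡∞ (y j) a (trans (sym (x≗ j)) xj≡∞)) ,
      (λ yj≡∞ → trans (x≗ j) (cong (_⊙ fin a) yj≡∞))

    +𝟏-rebase : ∀ {x y z : Vec𝒥 n} {a b} → x ≗ z +𝟏 a → y ≗ z +𝟏 b → x ≗ y +𝟏 (- b + a)
    +𝟏-rebase {x} {y} {z} {a} {b} x≗ y≗ j = begin
      x j                                  ≡⟨ x≗ j ⟩
      z j ⊙ fin a                          ≡⟨ cong (_⊙ fin a) (sym (⊙-cancel-fin (z j) b)) ⟩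
      ((z j ⊙ fin b) ⊙ fin (- b)) ⊙ fin a  ≡⟨ cong (λ t → (t ⊙ fin (- b)) ⊙ fin a) (sym (y≗ j)) ⟩
      (y j ⊙ fin (- b)) ⊙ fin a            ≡⟨ ⊙-assoc-fin (y j) (- b) a ⟩
      y j ⊙ fin (- b + a)                  ∎
      where open ≡-Reasoning

    Orth-resp : ∀ {x x′ y y′ : Vec𝒥 n} → x ≗ x′ → y ≗ y′ → Orth x y → Orth x′ y′
    Orth-resp x≗ y≗ = MinTwice-ext λ k → cong₂ _⊙_ (x≗ k) (y≗ k)

    Orth-+𝟏 : ∀ {x y : Vec𝒥 n} a b → Orth x y → Orth (x +𝟏 a) (y +𝟏 b)
    Orth-+𝟏 {x} {y} a b xy =
      MinTwice-ext (λ k → sym (⊙-interchange-fin (x k) (y k) a b)) (MinTwice-shift (a + b) xy)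

    _≟𝒥_ : DecidableEquality (𝒥 n)
    _≟𝒥_ = ≡-dec _≟Fin_ _≟Fin_

    any𝒥? : {P : 𝒥 n → Set} → (∀ j → Dec (P j)) → Dec (∃ P)
    any𝒥? P? = map′
      (λ { (inj₁ (i , Pi)) → inj₁ i , Pi ; (inj₂ (i , Pi)) → inj₂ i , Pi })
      (λ { (inj₁ i , Pi) → inj₁ (i , Pi) ; (inj₂ i , Pi) → inj₂ (i , Pi) })
      (any? (P? ∘ inj₁) ⊎-dec any? (P? ∘ inj₂))

    lookup-⁅⁆-same : ∀ (i : Fin n) → lookup ⁅ i ⁆ i ≡ true
    lookup-⁅⁆-same i = []=⇒lookup (x∈⁅x⁆ i)

    lookup-⁅⁆-other : ∀ {i l : Fin n} → i ≢ l → lookup ⁅ i ⁆ l ≡ false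
    lookup-⁅⁆-other {i} {l} i≢l =
      ¬-not λ e → i≢l (sym (x∈⁅y⁆⇒x≡y i (lookup⇒[]= l ⁅ i ⁆ e)))

    lookup-Δ⁅⁆-same : ∀ (S : Subset n) i → lookup (S Δ ⁅ i ⁆) i ≡ not (lookup S i)
    lookup-Δ⁅⁆-same S i = begin
      lookup (S Δ ⁅ i ⁆) i           ≡⟨ lookup-zipWith _xor_ i S ⁅ i ⁆ ⟩
      lookup S i xor lookup ⁅ i ⁆ i  ≡⟨ cong (lookup S i xor_) (lookup-⁅⁆-same i) ⟩
      lookup S i xor true            ≡⟨ xor-comm (lookup S i) true ⟩
      not (lookup S i)               ∎
      where open ≡-Reasoning

    lookup-Δ⁅⁆-other : ∀ (S : Subset n) {i l} → i ≢ l → lookup (S Δ ⁅ i ⁆) l ≡ lookup S l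
    lookup-Δ⁅⁆-other S {i} {l} i≢l = begin
      lookup (S Δ ⁅ i ⁆) l           ≡⟨ lookup-zipWith _xor_ l S ⁅ i ⁆ ⟩
      lookup S l xor lookup ⁅ i ⁆ l  ≡⟨ cong (lookup S l xor_) (lookup-⁅⁆-other i≢l) ⟩
      lookup S l xor false           ≡⟨ xor-identityʳ (lookup S l) ⟩
      lookup S l                     ∎
      where open ≡-Reasoning

    bar-Δ⁅⁆-same : ∀ (S : Subset n) j → barB (S Δ ⁅ base j ⁆) j ≡ not (barB S j)
    bar-Δ⁅⁆-same S (inj₁ i) = lookup-Δ⁅⁆-same S i
    bar-Δ⁅⁆-same S (inj₂ i) = cong not (lookup-Δ⁅⁆-same S i)

    bar-Δ⁅⁆-other : ∀ (S : Subset n) {i} k → i ≢ base k → barB (S Δ ⁅ i ⁆) k ≡ barB S k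
    bar-Δ⁅⁆-other S (inj₁ l) i≢l = lookup-Δ⁅⁆-other S i≢l
    bar-Δ⁅⁆-other S (inj₂ l) i≢l = cong not (lookup-Δ⁅⁆-other S i≢l)

    bar-* : ∀ (S : Subset n) j → barB S (j *) ≡ not (barB S j)
    bar-* S (inj₁ i) = refl
    bar-* S (inj₂ i) = sym (not-involutive (lookup S i))

    bar-∁ : ∀ (S : Subset n) j → barB (∁ S) j ≡ not (barB S j)
    bar-∁ S (inj₁ i) = lookup-map i not S
    bar-∁ S (inj₂ i) = cong not (lookup-map i not S)

    bar-xor : ∀ (S U : Subset n) k → barB S k xor barB U k ≡ lookup (S Δ U) (base k)
    bar-xor S U (inj₁ i) = sym (lookup-zipWith _xor_ i S U)
    bar-xor S U (inj₂ i) =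
      trans (xor-annihilates-not (lookup S i) (lookup U i)) (sym (lookup-zipWith _xor_ i S U))

    bar-Δ-inside : ∀ (S U : Subset n) k → barB U k ≡ true →
                   lookup (S Δ U) (base k) ≡ not (barB S k)
    bar-Δ-inside S U k Uk = begin
      lookup (S Δ U) (base k)  ≡⟨ sym (bar-xor S U k) ⟩
      barB S k xor barB U k    ≡⟨ cong (barB S k xor_) Uk ⟩
      barB S k xor true        ≡⟨ xor-comm (barB S k) true ⟩
      not (barB S k)           ∎
      where open ≡-Reasoning

    base-injective-outside : ∀ (S : Subset n) {j k} → barB S j ≡ false → barB S k ≡ false →
                             base j ≡ base k → j ≡ k
    base-injective-outside S {inj₁ i} {inj₁ _} _  _  refl = refl
    base-injective-outside S {inj₂ i} {inj₂ _} _  _  refl = refl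
    base-injective-outside S {inj₁ i} {inj₂ _} Sj Sk refl = contradiction (sym Sk) (not-¬ (sym Sj))
    base-injective-outside S {inj₂ i} {inj₁ _} Sj Sk refl = contradiction (sym Sj) (not-¬ (sym Sk))

    Avoids : Subset n → Pred𝒥 n → Set
    Avoids S A = ∀ k → A k → barB S k ≡ false

    avoids⇒admissible : ∀ {S} {A : Pred𝒥 n} → Avoids S A → Admissible A
    avoids⇒admissible {S} av j (Aj , Aj*) =
      contradiction (trans (sym (av (j *) Aj*)) (bar-* S j)) (not-¬ (sym (av j Aj)))

    over : Bool → Fin n → 𝒥 n
    over true  = inj₁
    over false = inj₂

    rep : Subset n → Fin n → 𝒥 n
    rep S i = over (lookup S i) i

    base-rep : ∀ S i → base (rep S i) ≡ i
    base-rep S i = base-over (lookup S i)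
      where
      base-over : ∀ b → base (over b i) ≡ i
      base-over true  = refl
      base-over false = refl

    bar-rep : ∀ S i → barB S (rep S i) ≡ true
    bar-rep S i = bar-over (lookup S i) refl
      where
      bar-over : ∀ b → lookup S i ≡ b → barB S (over b i) ≡ true
      bar-over true  Si = Si
      bar-over false Si = cong not Si

    rep-base : ∀ S k → barB S k ≡ true → rep S (base k) ≡ k
    rep-base S (inj₁ i) Sk = cong (λ b → over b i) Sk
    rep-base S (inj₂ i) Sk = cong (λ b → over b i) (not-injective {y = false} Sk)

    rep-Δ⁅⁆-same : ∀ S i → rep (S Δ ⁅ i ⁆) i ≡ rep S i *
    rep-Δ⁅⁆-same S i = trans (cong (λ b → over b i) (lookup-Δ⁅⁆-same S i)) (over-not (lookup S i))
      where
      over-not : ∀ b → over (not b) i ≡ over b i *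
      over-not true  = refl
      over-not false = refl

    rep-Δ⁅⁆-other : ∀ S {i l} → i ≢ l → rep (S Δ ⁅ i ⁆) l ≡ rep S l
    rep-Δ⁅⁆-other S {l = l} i≢l = cong (λ b → over b l) (lookup-Δ⁅⁆-other S i≢l)

    -- supp x ∩ B̄, indexed by [n].
    meet : Vec𝒥 n → Subset n → Subset n
    meet x B = tabulate λ i → isFinite (x (rep B i))

    ∈meet⇒finite : ∀ {x B i} → i ∈ meet x B → x (rep B i) ≢ ∞
    ∈meet⇒finite {x} {B} {i} i∈ =
      isFinite-true (trans (sym (lookup∘tabulate (λ l → isFinite (x (rep B l))) i)) ([]=⇒lookup i∈))

    finite⇒∈meet : ∀ {x B i} → x (rep B i) ≢ ∞ → i ∈ meet x B
    finite⇒∈meet {x} {B} {i} xi =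
      lookup⇒[]= i (meet x B)
        (trans (lookup∘tabulate (λ l → isFinite (x (rep B l))) i) (finite⇒isFinite xi))

    meet-⊂ : ∀ {x : Vec𝒥 n} {B B′} → (∀ i → x (rep B′ i) ≢ ∞ → x (rep B i) ≢ ∞) →
             (∃ λ (i : Fin n) → x (rep B i) ≢ ∞ × x (rep B′ i) ≡ ∞) → meet x B′ ⊂ meet x B
    meet-⊂ {x} {B} {B′} below (i , xi , x′i) =
      (λ {l} l∈ → finite⇒∈meet {x} {B} (below l (∈meet⇒finite {x} {B′} l∈))) ,
      i , finite⇒∈meet {x} {B} xi , λ i∈ → ∈meet⇒finite {x} {B′} i∈ x′i

    meet-shrinks : ∀ {x : Vec𝒥 n} {B j k} → Admissible (supp x) →
                   barB B j ≡ true → x j ≢ ∞ →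
                   barB (B Δ ⁅ base j ⁆) k ≡ false → x k ≡ ∞ →
                   meet x ((B Δ ⁅ base j ⁆) Δ ⁅ base k ⁆) ⊂ meet x B
    meet-shrinks {x} {B} {j} {k} adm Bj xj Tk xk =
      meet-⊂ {x} {B} {B′} below (base j , xrep-j , x′rep-j)
      where
      T  = B Δ ⁅ base j ⁆
      B′ = T Δ ⁅ base k ⁆
      Tj : barB T j ≡ false
      Tj = trans (bar-Δ⁅⁆-same B j) (cong not Bj)
      k≢j : base k ≢ base j
      k≢j e = xj (subst (λ l → x l ≡ ∞) (base-injective-outside T Tk Tj e) xk)
      rep′-j : rep B′ (base j) ≡ j *
      rep′-j = begin
        rep B′ (base j)    ≡⟨ rep-Δ⁅⁆-other T k≢j ⟩
        rep T (base j)     ≡⟨ rep-Δ⁅⁆-same B (base j) ⟩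
        rep B (base j) *   ≡⟨ cong _* (rep-base B j Bj) ⟩
        j *                ∎
        where open ≡-Reasoning
      rep′-k : rep B′ (base k) ≡ k
      rep′-k = rep-base B′ k (trans (bar-Δ⁅⁆-same T k) (cong not Tk))
      xrep-j : x (rep B (base j)) ≢ ∞
      xrep-j = subst (λ l → x l ≢ ∞) (sym (rep-base B j Bj)) xj
      x′rep-j : x (rep B′ (base j)) ≡ ∞
      x′rep-j = trans (cong x rep′-j) (decidable-stable (x (j *) ≟∞) λ xj* → adm j (xj , xj*))
      below : ∀ i → x (rep B′ i) ≢ ∞ → x (rep B i) ≢ ∞
      below i x′i with base j ≟Fin i | base k ≟Fin i
      ... | yes refl | _        = contradiction x′rep-j x′i
      ... | no _     | yes refl = contradiction (trans (cong x rep′-k) xk) x′i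
      ... | no j≢i   | no k≢i   =
        subst (λ l → x l ≢ ∞) (trans (rep-Δ⁅⁆-other T k≢i) (rep-Δ⁅⁆-other B j≢i)) x′i

  -- Circuits and cocircuits

  module _ {n : ℕ} (p : Subset n → 𝕋) where

    c-inside : ∀ T j → barB T j ≡ true → c p T j ≡ p (T Δ ⁅ base j ⁆)
    c-inside T j Tj = cong (λ b → if b then p (T Δ ⁅ base j ⁆) else ∞) Tj

    c-outside : ∀ T j → barB T j ≡ false → c p T j ≡ ∞
    c-outside T j Tj = cong (λ b → if b then p (T Δ ⁅ base j ⁆) else ∞) Tj

    c*-inside : ∀ T j → barB T j ≡ true → c* p T j ≡ ∞
    c*-inside T j Tj = cong (λ b → if b then ∞ else p (T Δ ⁅ base j ⁆)) Tj

    c*-outside : ∀ T j → barB T j ≡ false → c* p T j ≡ p (T Δ ⁅ base j ⁆)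
    c*-outside T j Tj = cong (λ b → if b then ∞ else p (T Δ ⁅ base j ⁆)) Tj

    supp-c*-avoids : ∀ T → Avoids T (supp (c* p T))
    supp-c*-avoids T j c*j = ¬-not λ Tj → c*j (c*-inside T j Tj)

    c-flip : ∀ B j → barB B j ≡ false → c p (B Δ ⁅ base j ⁆) j ≡ p B
    c-flip B j Bj = trans (c-inside _ j (trans (bar-Δ⁅⁆-same B j) (cong not Bj)))
                          (cong p (Δ-cancelʳ B ⁅ base j ⁆))

    c*-flip : ∀ B j → barB B j ≡ true → c* p (B Δ ⁅ base j ⁆) j ≡ p B
    c*-flip B j Bj = trans (c*-outside _ j (trans (bar-Δ⁅⁆-same B j) (cong not Bj)))
                           (cong p (Δ-cancelʳ B ⁅ base j ⁆))

    c-isCircuit : ∀ A j → c p A j ≢ ∞ → IsCircuit p (c p A)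
    c-isCircuit A j cj = (A , 0ℝ , λ k → sym (⊙-identityʳ (c p A k))) , j , cj

    ⊙c-vanishes : ∀ (x : Vec𝒥 n) A l → (x l ≢ ∞ → barB A l ≡ false) → x l ⊙ c p A l ≡ ∞
    ⊙c-vanishes x A l outside with x l ≟∞
    ... | yes xl≡∞ = cong (_⊙ c p A l) xl≡∞
    ... | no xl    = trans (cong (x l ⊙_) (c-outside A l (outside xl))) (⊙-zeroʳ (x l))

    ⊥circuits-not-avoids : ∀ {x B} → InCircuitsPerp p x → NonemptySupp x → p B ≢ ∞ →
                           ¬ Avoids B (supp x)
    ⊥circuits-not-avoids {x} {B} perp (j , xj) pB av =
      MinTwice-not-single _≟𝒥_ (perp (c p A) (c-isCircuit A j cAj)) j
        (⊙-finite xj cAj) λ l l≢j → ⊙c-vanishes x A l λ xl → Al l l≢j xl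
      where
      A = B Δ ⁅ base j ⁆
      cAj : c p A j ≢ ∞
      cAj = pB ∘ trans (sym (c-flip B j (av j xj)))
      Al : ∀ l → l ≢ j → x l ≢ ∞ → barB A l ≡ false
      Al l l≢j xl = trans (bar-Δ⁅⁆-other B l j≢l) (av l xl)
        where
        j≢l : base j ≢ base l
        j≢l e = l≢j (sym (base-injective-outside B (av j xj) (av l xl) e))

    ⊥circuits-meet-bar : ∀ {x B} → InCircuitsPerp p x → NonemptySupp x → p B ≢ ∞ →
                         ∃ λ j → barB B j ≡ true × x j ≢ ∞
    ⊥circuits-meet-bar {x} {B} perp ne pB
      with any𝒥? (λ j → (barB B j ≟𝔹 true) ×-dec ¬? (x j ≟∞))
    ... | yes found = found
    ... | no none   =
      ⊥-elim (⊥circuits-not-avoids perp ne pB λ k xk → ¬-not λ Bk → none (k , Bk , xk))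

    ⊥circuits-dependent-in-dual : ∀ {x} → InCircuitsPerp p x → NonemptySupp x →
                                  Dependent (BasesM* p) (supp x)
    ⊥circuits-dependent-in-dual perp ne (B , p∁B , x⊆B̄) with ⊥circuits-meet-bar perp ne p∁B
    ... | j , ∁Bj , xj = contradiction ∁Bj (not-¬ (trans (bar-∁ B j) (cong not (x⊆B̄ j xj))))

    ⊥circuits-exchange : ∀ {x T j j₀} → InCircuitsPerp p x → Avoids T (supp x) →
                         x j ≢ ∞ → x j₀ ≢ ∞ → j ≢ j₀ → c* p T j₀ ≢ ∞ →
                         x j ⊙ c* p T j₀ ≡ x j₀ ⊙ c* p T j
    ⊥circuits-exchange {x} {T} {j} {j₀} perp av xj xj₀ j≢j₀ c*j₀ = begin
      x j ⊙ c* p T j₀   ≡⟨ cong (x j ⊙_) (sym cA-j) ⟩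
      x j ⊙ c p A j     ≡⟨ MinTwice-pair _≟𝒥_ orth j j₀ (⊙-finite xj cAj) vanish ⟩
      x j₀ ⊙ c p A j₀   ≡⟨ cong (x j₀ ⊙_) cA-j₀ ⟩
      x j₀ ⊙ c* p T j   ∎
      where
      open ≡-Reasoning
      A = (T Δ ⁅ base j ⁆) Δ ⁅ base j₀ ⁆
      base-≢ : ∀ {i l} → x i ≢ ∞ → x l ≢ ∞ → i ≢ l → base i ≢ base l
      base-≢ xi xl i≢l = i≢l ∘ base-injective-outside T (av _ xi) (av _ xl)
      Aj : barB A j ≡ true
      Aj = trans (bar-Δ⁅⁆-other _ j (base-≢ xj₀ xj (j≢j₀ ∘ sym)))
                 (trans (bar-Δ⁅⁆-same T j) (cong not (av j xj)))
      cA-j : c p A j ≡ c* p T j₀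
      cA-j = begin
        c p A j              ≡⟨ c-inside A j Aj ⟩
        p (A Δ ⁅ base j ⁆)   ≡⟨ cong p (Δ-exchange T ⁅ base j ⁆ ⁅ base j₀ ⁆) ⟩
        p (T Δ ⁅ base j₀ ⁆)  ≡⟨ sym (c*-outside T j₀ (av j₀ xj₀)) ⟩
        c* p T j₀            ∎
      cA-j₀ : c p A j₀ ≡ c* p T j
      cA-j₀ = begin
        c p A j₀             ≡⟨ c-flip _ j₀ (trans (bar-Δ⁅⁆-other T j₀ (base-≢ xj xj₀ j≢j₀))
                                                   (av j₀ xj₀)) ⟩
        p (T Δ ⁅ base j ⁆)   ≡⟨ sym (c*-outside T j (av j xj)) ⟩
        c* p T j             ∎
      cAj : c p A j ≢ ∞
      cAj = c*j₀ ∘ trans (sym cA-j)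
      orth : Orth x (c p A)
      orth = perp (c p A) (c-isCircuit A j cAj)
      vanish : ∀ l → l ≢ j → l ≢ j₀ → x l ⊙ c p A l ≡ ∞
      vanish l l≢j l≢j₀ = ⊙c-vanishes x A l λ xl →
        trans (bar-Δ⁅⁆-other _ l (base-≢ xj₀ xl (l≢j₀ ∘ sym)))
              (trans (bar-Δ⁅⁆-other T l (base-≢ xj xl (l≢j ∘ sym))) (av l xl))

    ⊥circuits-shift-of-c* : ∀ {x T} → InCircuitsPerp p x → SameSupp x (c* p T) → NonemptySupp x →
                            ∃ λ a → x ≗ c* p T +𝟏 a
    ⊥circuits-shift-of-c* {x} {T} perp same (j₀ , xj₀)
      with fin-of (x j₀) xj₀ | fin-of (c* p T j₀) (SameSupp⇒⊆ same j₀ xj₀)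
    ... | a₀ , xj₀≡a₀ | c₀ , c*j₀≡c₀ =
      a₀ + - c₀ , λ j → ⊙-balance (x j) (c* p T j) a₀ c₀ (balanced j)
      where
      balanced : ∀ j → x j ⊙ fin c₀ ≡ fin a₀ ⊙ c* p T j
      balanced j with x j ≟∞ | j ≟𝒥 j₀
      ... | yes xj≡∞ | _ =
        trans (cong (_⊙ fin c₀) xj≡∞) (sym (cong (fin a₀ ⊙_) (proj₁ (same j) xj≡∞)))
      ... | no _ | yes refl = trans (cong (_⊙ fin c₀) xj₀≡a₀) (cong (fin a₀ ⊙_) (sym c*j₀≡c₀))
      ... | no xj | no j≢j₀ = begin
        x j ⊙ fin c₀        ≡⟨ cong (x j ⊙_) (sym c*j₀≡c₀) ⟩
        x j ⊙ c* p T j₀     ≡⟨ ⊥circuits-exchange perp avoids xj xj₀ j≢j₀ c*j₀ ⟩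
        x j₀ ⊙ c* p T j     ≡⟨ cong (_⊙ c* p T j) xj₀≡a₀ ⟩
        fin a₀ ⊙ c* p T j   ∎
        where
        open ≡-Reasoning
        c*j₀ = SameSupp⇒⊆ same j₀ xj₀
        avoids : Avoids T (supp x)
        avoids k xk = supp-c*-avoids T k (SameSupp⇒⊆ same k xk)

    c*-minimal : ∀ {y T} → InCircuitsPerp p y → NonemptySupp y →
                 supp y ⊆𝒥 supp (c* p T) → supp (c* p T) ⊆𝒥 supp y
    c*-minimal {y} {T} perp ne y⊆c* j c*j yj≡∞ = ⊥circuits-not-avoids perp ne pB avoids
      where
      Tj = supp-c*-avoids T j c*j
      pB : p (T Δ ⁅ base j ⁆) ≢ ∞
      pB = c*j ∘ trans (c*-outside T j Tj)
      avoids : Avoids (T Δ ⁅ base j ⁆) (supp y)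
      avoids k yk = trans (bar-Δ⁅⁆-other T k j≢k) Tk
        where
        Tk = supp-c*-avoids T k (y⊆c* k yk)
        j≢k : base j ≢ base k
        j≢k e = yk (subst (λ l → y l ≡ ∞) (base-injective-outside T Tj Tk e) yj≡∞)

    CocircuitInside : Vec𝒥 n → Set
    CocircuitInside x = ∃ λ T → NonemptySupp (c* p T) × supp (c* p T) ⊆𝒥 supp x

    descent-step : ∀ {x B} → InCircuitsPerp p x → Admissible (supp x) → NonemptySupp x →
                   p B ≢ ∞ → CocircuitInside x ⊎ ∃ λ B′ → p B′ ≢ ∞ × meet x B′ ⊂ meet x B
    descent-step {x} {B} perp adm ne pB with ⊥circuits-meet-bar perp ne pB
    ... | j , Bj , xj with any𝒥? (λ k → ¬? (c* p (B Δ ⁅ base j ⁆) k ≟∞) ×-dec (x k ≟∞))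
    ...   | no none =
      inj₁ (_ , (j , pB ∘ trans (sym (c*-flip B j Bj))) , λ k c*k xk → none (k , c*k , xk))
    ...   | yes (k , c*k , xk) =
      inj₂ (_ , c*k ∘ trans (c*-outside _ k Tk) , meet-shrinks adm Bj xj Tk xk)
      where Tk = supp-c*-avoids _ k c*k

    cocircuit-inside : ∀ {x B} → InCircuitsPerp p x → Admissible (supp x) → NonemptySupp x →
                       p B ≢ ∞ → CocircuitInside x
    cocircuit-inside {x} {B} perp adm ne pB = go pB (On.wellFounded (meet x) ⊂-wellFounded B)
      where
      go : ∀ {B} → p B ≢ ∞ → Acc (_⊂_ on meet x) B → CocircuitInside x
      go pB (acc rec) with descent-step perp adm ne pB
      ... | inj₁ found              = found
      ... | inj₂ (_ , pB′ , shrink) = go pB′ (rec shrink)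

    module _ (wick : IsWick p) where

      c*⊥c : ∀ T A → Orth (c* p T) (c p A)
      c*⊥c T A = MinTwice-reindex (rep A) base (base-rep A) at-rep cover (wick T A)
        where
        at-rep : ∀ i → i ∈ T Δ A →
                 c* p T (rep A i) ⊙ c p A (rep A i) ≡ p (T Δ ⁅ i ⁆) ⊙ p (A Δ ⁅ i ⁆)
        at-rep i i∈ = begin
          c* p T k ⊙ c p A k
            ≡⟨ cong₂ _⊙_ (c*-outside T k Tk) (c-inside A k Ak) ⟩
          p (T Δ ⁅ base k ⁆) ⊙ p (A Δ ⁅ base k ⁆)
            ≡⟨ cong (λ l → p (T Δ ⁅ l ⁆) ⊙ p (A Δ ⁅ l ⁆)) (base-rep A i) ⟩
          p (T Δ ⁅ i ⁆) ⊙ p (A Δ ⁅ i ⁆)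
            ∎
          where
          open ≡-Reasoning
          k = rep A i
          Ak = bar-rep A i
          Tk : barB T k ≡ false
          Tk = not-injective {y = false}
                 (trans (sym (bar-Δ-inside T A k Ak))
                        (trans (cong (lookup (T Δ A)) (base-rep A i)) ([]=⇒lookup i∈)))
        cover : ∀ k → c* p T k ⊙ c p A k ≡ ∞ ⊎
                      (base k ∈ T Δ A ×
                       c* p T k ⊙ c p A k ≡ p (T Δ ⁅ base k ⁆) ⊙ p (A Δ ⁅ base k ⁆))
        cover k with barB T k in Tk | barB A k in Ak
        ... | true  | _     = inj₁ refl
        ... | false | false = inj₁ (⊙-zeroʳ _)
        ... | false | true  =
          inj₂ (lookup⇒[]= (base k) (T Δ A) (trans (bar-Δ-inside T A k Ak) (cong not Tk)) , refl)

      cocircuit-⊥ : ∀ {x} T a → x ≗ c* p T +𝟏 a → InCircuitsPerp p x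
      cocircuit-⊥ T a x≗ y ((A , b , y≗) , _) =
        Orth-resp (sym ∘ x≗) (sym ∘ y≗) (Orth-+𝟏 a b (c*⊥c T A))

      cocircuit-isCocycle : ∀ {x} T a → x ≗ c* p T +𝟏 a → IsCocycle p x
      cocircuit-isCocycle T a x≗ =
        cocircuit-⊥ T a x≗ ,
        avoids⇒admissible λ k xk → supp-c*-avoids T k (SameSupp⇒⊆ (≗+𝟏⇒SameSupp x≗) k xk)

      c*-isCocycle : ∀ T → IsCocycle p (c* p T)
      c*-isCocycle T = cocircuit-isCocycle T 0ℝ (sym ∘ ⊙-identityʳ ∘ c* p T)

      minimalCocycle⇔cocircuit : ∃ (λ B → p B ≢ ∞) → ∀ {x} →
                                 IsMinimalCocycle p x ⇔ IsCocircuit p x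
      minimalCocycle⇔cocircuit (B , pB) {x} = mk⇔ to from
        where
        to : IsMinimalCocycle p x → IsCocircuit p x
        to ((perp , adm) , ne , minimal) =
          let T , ne* , c*⊆x = cocircuit-inside perp adm ne pB
              x⊆c*           = minimal (c* p T) (c*-isCocycle T) ne* c*⊆x
              a , x≗         = ⊥circuits-shift-of-c* perp (⊆⊇⇒SameSupp x⊆c* c*⊆x) ne
          in (T , a , x≗) , ne
        from : IsCocircuit p x → IsMinimalCocycle p x
        from ((T , a , x≗) , ne) = cocircuit-isCocycle T a x≗ , ne , minimal
          where
          same = ≗+𝟏⇒SameSupp x≗
          minimal : ∀ y → IsCocycle p y → NonemptySupp y → supp y ⊆𝒥 supp x → supp x ⊆𝒥 supp y
          minimal y (perp , _) ney y⊆x j xj =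
            c*-minimal perp ney (λ k yk → SameSupp⇒⊆ same k (y⊆x k yk)) j (SameSupp⇒⊆ same j xj)

      cocircuits-proportional : ∀ {c₁ c₂ : Vec𝒥 n} → IsCocircuit p c₁ → IsCocircuit p c₂ →
                                SameSupp c₁ c₂ → ∃ λ a → c₁ ≗ c₂ +𝟏 a
      cocircuits-proportional ((T₁ , a₁ , c₁≗) , ne₁) ((T₂ , a₂ , c₂≗) , _) same =
        let a , c₁≗c*₂ = ⊥circuits-shift-of-c* (cocircuit-⊥ T₁ a₁ c₁≗)
                           (SameSupp-trans same (≗+𝟏⇒SameSupp c₂≗)) ne₁
        in - a₂ + a , +𝟏-rebase c₁≗c*₂ c₂≗

mainTheorem8 : (R : Reals) → let open Tropical R in
    (n : ℕ) (p : Subset n → 𝕋) → IsWick p → Σ (Subset n) (λ B → p B ≢ ∞) →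
    ((x : Vec𝒥 n) → InCircuitsPerp p x → NonemptySupp x →
        Dependent (BasesM* p) (supp x))
    × ((x : Vec𝒥 n) → IsMinimalCocycle p x ⇔ IsCocircuit p x)
    × ((c₁ c₂ : Vec𝒥 n) → IsCocircuit p c₁ → IsCocircuit p c₂ →
        (∀ j → (c₁ j ≡ ∞ → c₂ j ≡ ∞) × (c₂ j ≡ ∞ → c₁ j ≡ ∞)) →
        Σ (Reals.ℝ R) (λ λ′ → ∀ j → c₁ j ≡ (c₂ +𝟏 λ′) j))
mainTheorem8 R n p wick basis =
    (λ x → ⊥circuits-dependent-in-dual p)
  , (λ x → minimalCocycle⇔cocircuit p wick basis)
  , (λ c₁ c₂ → cocircuits-proportional p wick)
  where open Proof R
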